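{- Let $X\subseteq B^n$ with $s(X)\ge 1$. Then $s(X)=1+\min\{\, s(Y)\mid Y\in\mathcal U(X)\,\}$, where $\mathcal U(X)=\{\, X^{[i,j]} \mid 1\le i<j\le n,\ X^{[i,j]} \text{ is not permutation-similar to } X\,\}$.
   Context: $B=\{0,1\}$. A comparator $[i,j]$ ($i\ne j\in\{1,\dots,n\}$) maps $x\in B^n$ to $x^{[i,j]}$, obtained by replacing $x_i$ by $\min(x_i,x_j)$ and $x_j$ by $\max(x_i,x_j)$; an exchange $(i,j)$ swaps entries $i$ and $j$. For a set of sequences $X$ and an operation $r$, $X^r=\{x^r\mid x\in X\}$. A permutation $\sigma$ of $\{1,\dots,n\}$ acts on $x$ by $(x^\sigma)_{\sigma(i)}=x_i$. Two sets $X,Y\subseteq B^n$ are permutation-similar if $X=Y^\sigma$ for some permutation $\sigma$. A comparator network on $n$ channels is a finite sequence of comparators and exchanges applied left to right; its size is its number of comparators. For $X\subseteq B^n$, $s(X)$ is the minimal size of a comparator network whose output on every $x\in X$ is sorted (nondecreasing). -}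

module Defs where

open import Data.Nat using (ℕ; zero; suc)
open import Data.Bool using (Bool; _∧_; _∨_)
import Data.Bool as B
open import Data.Fin using (Fin)
import Data.Fin as F
open import Data.Fin.Permutation using (Permutation′; _⟨$⟩ˡ_)
open import Data.Vec using (Vec; lookup; tabulate; _[_]≔_)
open import Data.List using (List; []; _∷_)
open import Data.Product using (Σ; _×_; ∃)
open import Relation.Binary.PropositionalEquality using (_≡_; _≢_)

-- binary sequences of length n (B^n), channels indexed by Fin n (0-based)
BSeq : ℕ → Set
BSeq n = Vec Bool n

SeqSet : ℕ → Set₁
SeqSet n = BSeq n → Set

_≐_ : ∀ {n} → SeqSet n → SeqSet n → Set
X ≐ Y = (∀ x → X x → Y x) × (∀ x → Y x → X x)

applyCmp : ∀ {n} → Fin n → Fin n → BSeq n → BSeq n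
applyCmp i j x = (x [ i ]≔ (lookup x i ∧ lookup x j)) [ j ]≔ (lookup x i ∨ lookup x j)

applyExch : ∀ {n} → Fin n → Fin n → BSeq n → BSeq n
applyExch i j x = (x [ i ]≔ lookup x j) [ j ]≔ lookup x i

-- permutation action: (x^σ)_{σ(i)} = x_i, i.e. (x^σ)_k = x_{σ⁻¹(k)}
applyPerm : ∀ {n} → Permutation′ n → BSeq n → BSeq n
applyPerm σ x = tabulate (λ k → lookup x (σ ⟨$⟩ˡ k))

image : ∀ {n} → (BSeq n → BSeq n) → SeqSet n → SeqSet n
image r X y = ∃ λ x → X x × r x ≡ y

PermSimilar : ∀ {n} → SeqSet n → SeqSet n → Set
PermSimilar {n} X Y = Σ (Permutation′ n) λ σ → X ≐ image (applyPerm σ) Y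

data Op (n : ℕ) : Set where
  cmp  : (i j : Fin n) → i ≢ j → Op n
  exch : (i j : Fin n) → i ≢ j → Op n

Network : ℕ → Set
Network n = List (Op n)

applyOp : ∀ {n} → Op n → BSeq n → BSeq n
applyOp (cmp i j _)  = applyCmp i j
applyOp (exch i j _) = applyExch i j

run : ∀ {n} → Network n → BSeq n → BSeq n
run []       x = x
run (o ∷ os) x = run os (applyOp o x)

size : ∀ {n} → Network n → ℕ
size []              = zero
size (cmp _ _ _ ∷ N)  = suc (size N)
size (exch _ _ _ ∷ N) = size N

Sorted : ∀ {n} → BSeq n → Set
Sorted x = ∀ i j → i F.≤ j → lookup x i B.≤ lookup x j

Sorts : ∀ {n} → Network n → SeqSet n → Set
Sorts N X = ∀ x → X x → Sorted (run N x)

IsMinSize : ∀ {n} → SeqSet n → ℕ → Set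
IsMinSize X k = (∃ λ N → Sorts N X × size N ≡ k)
              × (∀ N → Sorts N X → k Data.Nat.≤ size N)
  where import Data.Nat

{-# OPTIONS --safe #-}
-- A minimal network for X of size k ≥ 1 can be normalised to begin with a standard
-- comparator [i,j], i < j: an exchange pushed to the right past a comparator only
-- relabels the comparator's channels, and a reversed comparator [j,i] is [i,j]
-- followed by the exchange (i,j). The rest of the network, of size k − 1, sorts
-- X^[i,j], and nothing smaller does, since prefixing [i,j] to a network sorting
-- X^[i,j] sorts X. Finally X^[i,j] is not permutation-similar to X: every
-- permutation is realised by exchanges alone, so X would be sorted with k − 1
-- comparators.
module Submission where

open import Defs
open import Data.Nat using (ℕ; zero; suc; _≤_; _+_)
open import Data.Nat.Properties using (suc-injective; ≤-pred; <-irrefl)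
open import Data.Fin using (Fin; _<_)
open import Data.Fin.Properties using (_≟_; <-cmp; <⇒≢)
import Data.Fin.Permutation as P
open import Data.Fin.Permutation using (Permutation′; _⟨$⟩ʳ_)
import Data.Fin.Permutation.Components as PC
open import Data.Fin.Permutation.Transposition.List
  using (TranspositionList; eval; decompose; eval-decompose)
open import Data.Bool using (_∧_; _∨_)
open import Data.Bool.Properties using (∧-comm; ∨-comm)
open import Data.Vec using (lookup; tabulate; _[_]≔_)
open import Data.Vec.Properties using (lookup∘update; lookup∘update′; lookup∘tabulate; tabulate∘lookup; tabulate-cong)
open import Data.Vec.Relation.Binary.Pointwise.Extensional using (ext; Pointwise-≡⇒≡)
open import Data.List using ([]; _∷_; _++_)
open import Data.Product using (Σ; _×_; ∃; _,_)
open import Data.Empty using (⊥-elim)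
open import Function using (_∘_; Injective; Injection)
open import Function.Properties.Inverse using (↔⇒↣)
open import Relation.Nullary using (¬_; Dec; yes; no)
open import Relation.Nullary.Decidable using (dec-true; dec-false)
open import Relation.Binary.Definitions using (tri<; tri≈; tri>)
open import Relation.Binary.PropositionalEquality
  using (_≡_; _≢_; refl; sym; trans; cong; cong₂; subst; _≗_; module ≡-Reasoning)

private
  variable
    n : ℕ

lookup-ext : {x y : BSeq n} → (∀ k → lookup x k ≡ lookup y k) → x ≡ y
lookup-ext h = Pointwise-≡⇒≡ (ext h)

relabel : (Fin n → Fin n) → BSeq n → BSeq n
relabel f x = tabulate (lookup x ∘ f)

lookup-relabel : (f : Fin n → Fin n) (x : BSeq n) (k : Fin n) →
                 lookup (relabel f x) k ≡ lookup x (f k)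
lookup-relabel f x = lookup∘tabulate (lookup x ∘ f)

relabel-cong : {f g : Fin n → Fin n} → f ≗ g → (x : BSeq n) → relabel f x ≡ relabel g x
relabel-cong f≗g x = tabulate-cong (cong (lookup x) ∘ f≗g)

relabel-relabel : (f g : Fin n → Fin n) (x : BSeq n) → relabel f (relabel g x) ≡ relabel (g ∘ f) x
relabel-relabel f g x = tabulate-cong (lookup-relabel g x ∘ f)

transpose-matchˡ : (i j : Fin n) → PC.transpose i j i ≡ j
transpose-matchˡ i j rewrite dec-true (i ≟ i) refl = refl

transpose-matchʳ : (i j : Fin n) → PC.transpose i j j ≡ i
transpose-matchʳ i j with j ≟ i
... | yes j≡i = j≡i
... | no _ rewrite dec-true (j ≟ j) refl = refl

transpose-mismatch : (i j k : Fin n) → k ≢ i → k ≢ j → PC.transpose i j k ≡ k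
transpose-mismatch i j k k≢i k≢j rewrite dec-false (k ≟ i) k≢i | dec-false (k ≟ j) k≢j = refl

transpose-diagonal : (i k : Fin n) → PC.transpose i i k ≡ k
transpose-diagonal i k = by-cases (k ≟ i)
  where
  by-cases : Dec (k ≡ i) → PC.transpose i i k ≡ k
  by-cases (yes k≡i) = subst (λ i → PC.transpose i i k ≡ k) k≡i (transpose-matchˡ k k)
  by-cases (no k≢i)  = transpose-mismatch i i k k≢i k≢i

transpose-injective : (i j : Fin n) → Injective _≡_ _≡_ (PC.transpose i j)
transpose-injective i j = Injection.injective (↔⇒↣ (P.transpose i j))

applyExch-relabel : (i j : Fin n) (x : BSeq n) → applyExch i j x ≡ relabel (PC.transpose i j) x
applyExch-relabel i j x = lookup-ext λ k → trans (at k (k ≟ j) (k ≟ i)) (sym (lookup-relabel (PC.transpose i j) x k))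
  where
  open ≡-Reasoning
  at : ∀ k → Dec (k ≡ j) → Dec (k ≡ i) → lookup (applyExch i j x) k ≡ lookup x (PC.transpose i j k)
  at k (yes refl) _ = begin
    lookup ((x [ i ]≔ lookup x j) [ j ]≔ lookup x i) j ≡⟨ lookup∘update j (x [ i ]≔ lookup x j) (lookup x i) ⟩
    lookup x i                                         ≡⟨ cong (lookup x) (sym (transpose-matchʳ i j)) ⟩
    lookup x (PC.transpose i j j)                      ∎
  at k (no k≢j) (yes refl) = begin
    lookup ((x [ i ]≔ lookup x j) [ j ]≔ lookup x i) i ≡⟨ lookup∘update′ k≢j (x [ i ]≔ lookup x j) (lookup x i) ⟩
    lookup (x [ i ]≔ lookup x j) i                     ≡⟨ lookup∘update i x (lookup x j) ⟩
    lookup x j                                         ≡⟨ cong (lookup x) (sym (transpose-matchˡ i j)) ⟩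
    lookup x (PC.transpose i j i)                      ∎
  at k (no k≢j) (no k≢i) = begin
    lookup ((x [ i ]≔ lookup x j) [ j ]≔ lookup x i) k ≡⟨ lookup∘update′ k≢j (x [ i ]≔ lookup x j) (lookup x i) ⟩
    lookup (x [ i ]≔ lookup x j) k                     ≡⟨ lookup∘update′ k≢i x (lookup x j) ⟩
    lookup x k                                         ≡⟨ cong (lookup x) (sym (transpose-mismatch i j k k≢i k≢j)) ⟩
    lookup x (PC.transpose i j k)                      ∎

applyCmp-lookupʳ : (i j : Fin n) (x : BSeq n) → lookup (applyCmp i j x) j ≡ (lookup x i ∨ lookup x j)
applyCmp-lookupʳ i j x = lookup∘update j (x [ i ]≔ (lookup x i ∧ lookup x j)) (lookup x i ∨ lookup x j)

applyCmp-lookupˡ : (i j : Fin n) (x : BSeq n) → i ≢ j → lookup (applyCmp i j x) i ≡ (lookup x i ∧ lookup x j)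
applyCmp-lookupˡ i j x i≢j = trans
  (lookup∘update′ i≢j (x [ i ]≔ (lookup x i ∧ lookup x j)) (lookup x i ∨ lookup x j))
  (lookup∘update i x (lookup x i ∧ lookup x j))

applyCmp-lookup-other : (i j k : Fin n) (x : BSeq n) → k ≢ i → k ≢ j → lookup (applyCmp i j x) k ≡ lookup x k
applyCmp-lookup-other i j k x k≢i k≢j = trans
  (lookup∘update′ k≢j (x [ i ]≔ (lookup x i ∧ lookup x j)) (lookup x i ∨ lookup x j))
  (lookup∘update′ k≢i x (lookup x i ∧ lookup x j))

applyCmp-relabel : (π : Fin n → Fin n) → Injective _≡_ _≡_ π → (i j : Fin n) → i ≢ j → (x : BSeq n) →
                   applyCmp i j (relabel π x) ≡ relabel π (applyCmp (π i) (π j) x)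
applyCmp-relabel {n} π π-inj i j i≢j x = lookup-ext λ k → trans (at k (k ≟ j) (k ≟ i)) (sym (lookup-relabel π y k))
  where
  y : BSeq n
  y = applyCmp (π i) (π j) x
  at : ∀ k → Dec (k ≡ j) → Dec (k ≡ i) → lookup (applyCmp i j (relabel π x)) k ≡ lookup y (π k)
  at k (yes refl) _ = trans (applyCmp-lookupʳ i j (relabel π x))
    (trans (cong₂ _∨_ (lookup-relabel π x i) (lookup-relabel π x j))
      (sym (applyCmp-lookupʳ (π i) (π j) x)))
  at k (no k≢j) (yes refl) = trans (applyCmp-lookupˡ i j (relabel π x) i≢j)
    (trans (cong₂ _∧_ (lookup-relabel π x i) (lookup-relabel π x j))
      (sym (applyCmp-lookupˡ (π i) (π j) x (i≢j ∘ π-inj))))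
  at k (no k≢j) (no k≢i) = trans (applyCmp-lookup-other i j k (relabel π x) k≢i k≢j)
    (trans (lookup-relabel π x k)
      (sym (applyCmp-lookup-other (π i) (π j) (π k) x (k≢i ∘ π-inj) (k≢j ∘ π-inj))))

applyCmp-flip : (i j : Fin n) → i ≢ j → (x : BSeq n) → applyCmp i j x ≡ applyExch i j (applyCmp j i x)
applyCmp-flip {n} i j i≢j x = lookup-ext λ k →
  trans (at k (k ≟ j) (k ≟ i)) (sym (trans (cong (λ v → lookup v k) (applyExch-relabel i j y)) (lookup-relabel _ y k)))
  where
  y : BSeq n
  y = applyCmp j i x
  at : ∀ k → Dec (k ≡ j) → Dec (k ≡ i) → lookup (applyCmp i j x) k ≡ lookup y (PC.transpose i j k)
  at k (yes refl) _ = begin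
    lookup (applyCmp i j x) j     ≡⟨ applyCmp-lookupʳ i j x ⟩
    lookup x i ∨ lookup x j       ≡⟨ ∨-comm (lookup x i) (lookup x j) ⟩
    lookup x j ∨ lookup x i       ≡⟨ applyCmp-lookupʳ j i x ⟨
    lookup y i                    ≡⟨ cong (lookup y) (transpose-matchʳ i j) ⟨
    lookup y (PC.transpose i j j) ∎
    where open ≡-Reasoning
  at k (no k≢j) (yes refl) = begin
    lookup (applyCmp i j x) i     ≡⟨ applyCmp-lookupˡ i j x k≢j ⟩
    lookup x i ∧ lookup x j       ≡⟨ ∧-comm (lookup x i) (lookup x j) ⟩
    lookup x j ∧ lookup x i       ≡⟨ applyCmp-lookupˡ j i x (k≢j ∘ sym) ⟨
    lookup y j                    ≡⟨ cong (lookup y) (transpose-matchˡ i j) ⟨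
    lookup y (PC.transpose i j i) ∎
    where open ≡-Reasoning
  at k (no k≢j) (no k≢i) = begin
    lookup (applyCmp i j x) k     ≡⟨ applyCmp-lookup-other i j k x k≢i k≢j ⟩
    lookup x k                    ≡⟨ applyCmp-lookup-other j i k x k≢j k≢i ⟨
    lookup y k                    ≡⟨ cong (lookup y) (transpose-mismatch i j k k≢i k≢j) ⟨
    lookup y (PC.transpose i j k) ∎
    where open ≡-Reasoning

applyCmp-applyExch : (a b i j : Fin n) → i ≢ j → (x : BSeq n) →
  applyCmp i j (applyExch a b x) ≡ applyExch a b (applyCmp (PC.transpose a b i) (PC.transpose a b j) x)
applyCmp-applyExch {n} a b i j i≢j x = begin
  applyCmp i j (applyExch a b x)         ≡⟨ cong (applyCmp i j) (applyExch-relabel a b x) ⟩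
  applyCmp i j (relabel t x)             ≡⟨ applyCmp-relabel t (transpose-injective a b) i j i≢j x ⟩
  relabel t (applyCmp (t i) (t j) x)     ≡⟨ applyExch-relabel a b (applyCmp (t i) (t j) x) ⟨
  applyExch a b (applyCmp (t i) (t j) x) ∎
  where
  open ≡-Reasoning
  t : Fin n → Fin n
  t = PC.transpose a b

run-++ : (N M : Network n) (x : BSeq n) → run (N ++ M) x ≡ run M (run N x)
run-++ []      M x = refl
run-++ (o ∷ N) M x = run-++ N M (applyOp o x)

size-++ : (N M : Network n) → size (N ++ M) ≡ size N + size M
size-++ []                 M = refl
size-++ (cmp _ _ _ ∷ N)  M = cong suc (size-++ N M)
size-++ (exch _ _ _ ∷ N) M = size-++ N M

StartsWithComparator : Network n → ℕ → Set
StartsWithComparator {n} N m =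
  Σ (Fin n) λ i → Σ (Fin n) λ j → i < j ×
  Σ (Network n) λ M → size M ≡ m × (∀ x → run N x ≡ run M (applyCmp i j x))

orient : (N : Network n) (m : ℕ) (i j : Fin n) → i ≢ j → (M : Network n) → size M ≡ m →
         (∀ x → run N x ≡ run M (applyCmp i j x)) → StartsWithComparator N m
orient N m i j i≢j M size-M run-N with <-cmp i j
... | tri< i<j _ _ = i , j , i<j , M , size-M , run-N
... | tri≈ _ i≡j _ = ⊥-elim (i≢j i≡j)
... | tri> _ _ j<i = j , i , j<i , exch i j i≢j ∷ M , size-M ,
                     λ x → trans (run-N x) (cong (run M) (applyCmp-flip i j i≢j x))

startsWithComparator : (N : Network n) (m : ℕ) → size N ≡ suc m → StartsWithComparator N m
startsWithComparator (cmp i j i≢j ∷ N) m size-N = orient (cmp i j i≢j ∷ N) m i j i≢j N (suc-injective size-N) λ _ → refl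
startsWithComparator {n} (exch a b a≢b ∷ N) m size-N with startsWithComparator N m size-N
... | i , j , i<j , M , size-M , run-N =
  orient (exch a b a≢b ∷ N) m (t i) (t j) (<⇒≢ i<j ∘ transpose-injective a b) (exch a b a≢b ∷ M) size-M
    λ x → trans (run-N (applyExch a b x)) (cong (run M) (applyCmp-applyExch a b i j (<⇒≢ i<j) x))
  where
  t : Fin n → Fin n
  t = PC.transpose a b

transpositionNetwork : Fin n → Fin n → Network n
transpositionNetwork a b with a ≟ b
... | yes _    = []
... | no a≢b = exch a b a≢b ∷ []

size-transpositionNetwork : (a b : Fin n) → size (transpositionNetwork a b) ≡ 0
size-transpositionNetwork a b with a ≟ b
... | yes _ = refl
... | no _  = refl

run-transpositionNetwork : (a b : Fin n) (x : BSeq n) →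
                           run (transpositionNetwork a b) x ≡ relabel (PC.transpose a b) x
run-transpositionNetwork a b x with a ≟ b
... | yes refl = sym (trans (relabel-cong (transpose-diagonal a) x) (tabulate∘lookup x))
... | no _     = applyExch-relabel a b x

swapNetwork : TranspositionList n → Network n
swapNetwork []            = []
swapNetwork ((a , b) ∷ L) = swapNetwork L ++ transpositionNetwork a b

size-swapNetwork : (L : TranspositionList n) → size (swapNetwork L) ≡ 0
size-swapNetwork []            = refl
size-swapNetwork ((a , b) ∷ L) = begin
  size (swapNetwork L ++ transpositionNetwork a b)        ≡⟨ size-++ (swapNetwork L) (transpositionNetwork a b) ⟩
  size (swapNetwork L) + size (transpositionNetwork a b) ≡⟨ cong₂ _+_ (size-swapNetwork L) (size-transpositionNetwork a b) ⟩
  0                                                       ∎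
  where open ≡-Reasoning

run-swapNetwork : (L : TranspositionList n) (x : BSeq n) → run (swapNetwork L) x ≡ relabel (eval L ⟨$⟩ʳ_) x
run-swapNetwork []            x = sym (tabulate∘lookup x)
run-swapNetwork ((a , b) ∷ L) x = begin
  run (swapNetwork L ++ transpositionNetwork a b) x                  ≡⟨ run-++ (swapNetwork L) (transpositionNetwork a b) x ⟩
  run (transpositionNetwork a b) (run (swapNetwork L) x)             ≡⟨ run-transpositionNetwork a b (run (swapNetwork L) x) ⟩
  relabel (PC.transpose a b) (run (swapNetwork L) x)                 ≡⟨ cong (relabel (PC.transpose a b)) (run-swapNetwork L x) ⟩
  relabel (PC.transpose a b) (relabel (eval L ⟨$⟩ʳ_) x)              ≡⟨ relabel-relabel (PC.transpose a b) (eval L ⟨$⟩ʳ_) x ⟩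
  relabel (eval ((a , b) ∷ L) ⟨$⟩ʳ_) x                               ∎
  where open ≡-Reasoning

-- applyPerm σ is definitionally relabel (P.flip σ ⟨$⟩ʳ_), hence the flip.
permutationNetwork : Permutation′ n → Network n
permutationNetwork σ = swapNetwork (decompose (P.flip σ))

size-permutationNetwork : (σ : Permutation′ n) → size (permutationNetwork σ) ≡ 0
size-permutationNetwork σ = size-swapNetwork (decompose (P.flip σ))

run-permutationNetwork : (σ : Permutation′ n) (x : BSeq n) → run (permutationNetwork σ) x ≡ applyPerm σ x
run-permutationNetwork σ x = trans (run-swapNetwork (decompose (P.flip σ)) x)
                                   (relabel-cong (eval-decompose (P.flip σ)) x)

sorts-via : (N M : Network n) {f : BSeq n → BSeq n} {X Y : SeqSet n} →
            (∀ x → run N x ≡ run M (f x)) → (∀ x → X x → Y (f x)) → Sorts M Y → Sorts N X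
sorts-via N M run-N f-X⊆Y M-sorts x x∈X = subst Sorted (sym (run-N x)) (M-sorts _ (f-X⊆Y x x∈X))

sorts-image : (N M : Network n) {f : BSeq n → BSeq n} {X : SeqSet n} →
              (∀ x → run N x ≡ run M (f x)) → Sorts N X → Sorts M (image f X)
sorts-image N M run-N N-sorts y (x , x∈X , refl) = subst Sorted (run-N x) (N-sorts x x∈X)

permSimilar-sorts : {X Y : SeqSet n} (M : Network n) → PermSimilar Y X → Sorts M Y →
                    ∃ λ N → Sorts N X × size N ≡ size M
permSimilar-sorts M (σ , _ , σX⊆Y) M-sorts =
  permutationNetwork σ ++ M ,
  sorts-via (permutationNetwork σ ++ M) M run-σM (λ x x∈X → σX⊆Y (applyPerm σ x) (x , x∈X , refl)) M-sorts ,
  trans (size-++ (permutationNetwork σ) M) (cong (_+ size M) (size-permutationNetwork σ))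
  where
  run-σM : ∀ x → run (permutationNetwork σ ++ M) x ≡ run M (applyPerm σ x)
  run-σM x = trans (run-++ (permutationNetwork σ) M x) (cong (run M) (run-permutationNetwork σ x))

minSize-≤-comparator-prefix : {X : SeqSet n} {k : ℕ} → IsMinSize X k → (i j : Fin n) → i ≢ j →
                              (M : Network n) → Sorts M (image (applyCmp i j) X) → k ≤ suc (size M)
minSize-≤-comparator-prefix (_ , minimal) i j i≢j M M-sorts =
  minimal (cmp i j i≢j ∷ M) (sorts-via (cmp i j i≢j ∷ M) M (λ _ → refl) (λ x x∈X → x , x∈X , refl) M-sorts)

mainTheorem7 : (n : ℕ) (X : SeqSet n) (k : ℕ) → IsMinSize X k → 1 ≤ k →
    (Σ (Fin n) λ i → Σ (Fin n) λ j → i < j ×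
       ¬ PermSimilar (image (applyCmp i j) X) X ×
       Σ ℕ λ m → IsMinSize (image (applyCmp i j) X) m × k ≡ 1 + m)
    × (∀ (i j : Fin n) → i < j → ¬ PermSimilar (image (applyCmp i j) X) X →
       ∀ m → IsMinSize (image (applyCmp i j) X) m → k ≤ 1 + m)
mainTheorem7 n X zero _ ()
mainTheorem7 n X (suc m) X-min@((N , N-sorts , size-N) , N-min) _
  with startsWithComparator N m size-N
... | i , j , i<j , M , size-M , run-N =
  (i , j , i<j , not-similar , m , ((M , M-sorts , size-M) , M-min) , refl) , at-most-one-more
  where
  M-sorts : Sorts M (image (applyCmp i j) X)
  M-sorts = sorts-image N M run-N N-sorts

  M-min : ∀ M′ → Sorts M′ (image (applyCmp i j) X) → m ≤ size M′
  M-min M′ M′-sorts = ≤-pred (minSize-≤-comparator-prefix X-min i j (<⇒≢ i<j) M′ M′-sorts)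

  not-similar : ¬ PermSimilar (image (applyCmp i j) X) X
  not-similar similar with permSimilar-sorts M similar M-sorts
  ... | N′ , N′-sorts , size-N′ = <-irrefl refl (subst (suc m ≤_) (trans size-N′ size-M) (N-min N′ N′-sorts))

  at-most-one-more : ∀ i′ j′ → i′ < j′ → ¬ PermSimilar (image (applyCmp i′ j′) X) X →
                     ∀ m′ → IsMinSize (image (applyCmp i′ j′) X) m′ → suc m ≤ 1 + m′
  at-most-one-more i′ j′ i′<j′ _ m′ ((M′ , M′-sorts , refl) , _) =
    minSize-≤-comparator-prefix X-min i′ j′ (<⇒≢ i′<j′) M′ M′-sorts
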